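{- Let $\mathcal{L}\in\mathcal{M}(N)$, $\mathcal{T}\in\mathcal{A}(N)$, let $\mathbb{A}=(\phi,\delta)$ abstract $(\mathcal{L},\mathcal{T})$, and let $(\mathcal{T},\mathbb{A})\models\mathsf{AxCmpl}$ with witness $t_{acc}$. For all states $q,q'$ of $\mathcal{L}$, every trace $s\in\mathsf{Act}^*$ and every finite $E\subseteq X$: if $q'\in\mathrm{ws}(q,s)$ then Must$\big(q,\ t_{acc}(\overline{s},\ E\setminus\mathrm{coR}_{\mathbb{A}}(q'))\big)$ does not hold. Here $\overline{s}$ is $s$ with every action replaced by its dual.
   Context: $\mathsf{Act}$ countable set of visible actions, $\tau\notin\mathsf{Act}$, $\mathsf{L}=\mathsf{Act}\cup\{\tau\}$, involutive duality $\mu\mapsto\overline{\mu}$; $N\subseteq\mathsf{Act}$ non-blocking, $B=\mathsf{Act}\setminus N$; LTSs finite-image. Axioms (all $\alpha\in\mathsf{L}$, $\eta\in N$, $\mu\in\mathsf{Act}$, $\mu\ne\eta$): N-delay: $p_1\xrightarrow{\eta}p_2\xrightarrow{\alpha}p_3\Rightarrow\exists p_4.\,p_1\xrightarrow{\alpha}p_4\xrightarrow{\eta}p_3$; N-confluence: $p_1\xrightarrow{\eta}p_2,p_1\xrightarrow{\mu}p_3\Rightarrow\exists p_4.\,p_2\xrightarrow{\mu}p_4,p_3\xrightarrow{\eta}p_4$; N-determinacy: $p_1\xrightarrow{\eta}p_2,p_1\xrightarrow{\eta}p_3\Rightarrow p_2=p_3$; backwards-N-determinacy: $p_2\xrightarrow{\eta}p_1,p_3\xrightarrow{\eta}p_1\Rightarrow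 p_2=p_3$; Fwd-Feedback: $p_1\xrightarrow{\eta}p_2\xrightarrow{\overline{\eta}}p_3\Rightarrow p_1\xrightarrow{\tau}p_3$ or $p_1=p_3$; Boomerang: each $p$ has $p'$ with $p\xrightarrow{\overline{\eta}}p'\xrightarrow{\eta}p$; N-tau: $p_1\xrightarrow{\eta}p_2,p_1\xrightarrow{\tau}p_3$ imply $\exists p_4.\,p_2\xrightarrow{\tau}p_4,p_3\xrightarrow{\eta}p_4$, or $p_2\xrightarrow{\overline{\eta}}p_3$; Feedback: $p\xrightarrow{\eta}q\xrightarrow{\overline{\eta}}q'\Rightarrow p\xrightarrow{\tau}q'$. $\mathcal{M}(N)$: LTSs with N-delay, N-confluence, N-determinacy, backwards-N-determinacy, Fwd-Feedback, Boomerang, N-tau. $\mathcal{A}(N)$: LTSs with N-delay, N-confluence, N-determinacy, backwards-N-determinacy, N-tau, Feedback. Composition of $p$ and test $t$: steps by $\tau$-moves of either side or by $p\xrightarrow{\overline{\mu}}p'$, $t\xrightarrow{\mu}t'$. good: decidable predicate on tests preserved in both directions by $N$-transitions. Must$(p,t)$ iff every maximal computation from $(p,t)$ contains a state with good test. $\mathrm{ws}(p,s)=\{q:p\overset{s}{\Rightarrow}q,\ q\not\xrightarrow{\tau}\}$ (weak transitions allow interleaved $\tau$-steps). $R(t)=\{\mu:t\xrightarrow{\mu}\}$, $\mathrm{coR}(p)=\{\beta\in B:p\xrightarrow{\overline{\beta}}\}$. Label abstraction $\mathbb{A}=(\phi:B\to Y,\delta:Y\to X)$, $\mathrm{coR}_{\mathbb{A}}(p)=\{\delta(\phi(\beta)):\beta\in\mathrm{coR}(p)\}$;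 abstracts $(\mathcal{L},\mathcal{T})$ if for all $\beta,\beta'\in B$: (i) for each test $t$, $\phi(\beta)=\phi(\beta')$, $\beta\in R(t)\Rightarrow\beta'\in R(t)$; (ii) for each $p$ in $\mathcal{L}$, $\delta(\phi(\beta))=\delta(\phi(\beta'))$, $\phi(\beta)\in\phi(\mathrm{coR}(p))\Rightarrow\phi(\beta')\in\phi(\mathrm{coR}(p))$. $(\mathcal{T},\mathbb{A})\models\mathsf{AxCmpl}$: there are $t_{cnv}:\mathsf{Act}^*\to T$, $t_{acc}:\mathsf{Act}^*\times\mathcal{P}_{fin}(X)\to T$ such that for all $s$, $\mu,\mu'\in\mathsf{Act}$, finite $E\subseteq X$, $f\in\{t_{cnv},t_{acc}(\cdot,E)\}$: (1) not good$(f(s))$; (2) $f(\mu.s)\xrightarrow{\mu}f(s)$; (3) $\mu\in B\Rightarrow f(\mu.s)\xrightarrow{\tau}$; (4) $\mu\in B$, $f(\mu.s)\xrightarrow{\tau}t\Rightarrow$ good$(t)$; (5) $\mu\in B$, $f(\mu.s)\xrightarrow{\mu}t\Rightarrow t=f(s)$; (6) $\mu\in B$, $f(\mu.s)\xrightarrow{\mu'}t$, $\mu'\ne\mu\Rightarrow$ good$(t)$; (a1) $t_{acc}(\varepsilon,E)\not\xrightarrow{\tau}$; (a2) $t_{acc}(\varepsilon,E)\not\xrightarrow{\eta}$, $\eta\in N$; (a3) $\beta\in B$, $t_{acc}(\varepsilon,E)\xrightarrow{\beta}\Rightarrow\delta(\phi(\beta))\in E$; (a4) each $e\in E$ is $\delta(\phi(\beta))$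 for some $\beta\in B$ with $t_{acc}(\varepsilon,E)\xrightarrow{\beta}$; (a5) $\beta\in B$, $t_{acc}(\varepsilon,E)\xrightarrow{\beta}t\Rightarrow$ good$(t)$; (c1) $t_{cnv}(\varepsilon)\not\xrightarrow{\mu}$, $\mu\in\mathsf{Act}$; (c2) $t_{cnv}(\varepsilon)\xrightarrow{\tau}$; (c3) $t_{cnv}(\varepsilon)\xrightarrow{\tau}t\Rightarrow$ good$(t)$. -}

module Defs where

open import Data.Nat using (ℕ; _≤_; _<_)
open import Data.List using (List; []; _∷_; map)
open import Data.List.Membership.Propositional using (_∈_)
open import Data.Product using (Σ; ∃; _×_; _,_; proj₁; proj₂)
open import Data.Sum using (_⊎_)
open import Relation.Nullary using (¬_; Dec)
open import Relation.Binary.PropositionalEquality using (_≡_; _≢_)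
open import Function.Definitions using (Injective)

record Setting : Set₁ where
  field
    Act        : Set
    countable  : Σ (Act → ℕ) (Injective _≡_ _≡_)
    dual       : Act → Act
    dual-invol : ∀ μ → dual (dual μ) ≡ μ
    N          : Act → Set

  B : Act → Set
  B μ = ¬ N μ

  BAct : Set
  BAct = Σ Act B

data Label (A : Set) : Set where
  τ   : Label A
  vis : A → Label A

record LTS (S : Setting) : Set₁ where
  open Setting S
  field
    State      : Set
    step       : State → Label Act → State → Set
    finite-img : ∀ p α → Σ (List State) λ xs → ∀ q → step p α q → q ∈ xs

module _ {S : Setting} (L : LTS S) where
  open Setting S
  open LTS L

  N-delay : Set
  N-delay = ∀ {η α p₁ p₂ p₃} → N η → step p₁ (vis η) p₂ → step p₂ α p₃ →
            ∃ λ p₄ → step p₁ α p₄ × step p₄ (vis η) p₃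

  N-confluence : Set
  N-confluence = ∀ {η μ p₁ p₂ p₃} → N η → μ ≢ η →
                 step p₁ (vis η) p₂ → step p₁ (vis μ) p₃ →
                 ∃ λ p₄ → step p₂ (vis μ) p₄ × step p₃ (vis η) p₄

  N-determinacy : Set
  N-determinacy = ∀ {η p₁ p₂ p₃} → N η →
                  step p₁ (vis η) p₂ → step p₁ (vis η) p₃ → p₂ ≡ p₃

  backwards-N-determinacy : Set
  backwards-N-determinacy = ∀ {η p₁ p₂ p₃} → N η →
                  step p₂ (vis η) p₁ → step p₃ (vis η) p₁ → p₂ ≡ p₃

  Fwd-Feedback : Set
  Fwd-Feedback = ∀ {η p₁ p₂ p₃} → N η →
                 step p₁ (vis η) p₂ → step p₂ (vis (dual η)) p₃ →
                 step p₁ τ p₃ ⊎ p₁ ≡ p₃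

  Boomerang : Set
  Boomerang = ∀ {η} → N η → ∀ p →
              ∃ λ p' → step p (vis (dual η)) p' × step p' (vis η) p

  N-tau : Set
  N-tau = ∀ {η p₁ p₂ p₃} → N η →
          step p₁ (vis η) p₂ → step p₁ τ p₃ →
          (∃ λ p₄ → step p₂ τ p₄ × step p₃ (vis η) p₄) ⊎ step p₂ (vis (dual η)) p₃

  Feedback : Set
  Feedback = ∀ {η p q q'} → N η →
             step p (vis η) q → step q (vis (dual η)) q' → step p τ q'

  record InM : Set where
    field
      ndelay  : N-delay
      nconfl  : N-confluence
      ndet    : N-determinacy
      bndet   : backwards-N-determinacy
      fwdfb   : Fwd-Feedback
      boom    : Boomerang
      ntau    : N-tau

  record InA : Set where
    field
      ndelay  : N-delay
      nconfl  : N-confluence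
      ndet    : N-determinacy
      bndet   : backwards-N-determinacy
      ntau    : N-tau
      fb      : Feedback

  data WT : State → List Act → State → Set where
    wt-refl : ∀ {p} → WT p [] p
    wt-tau  : ∀ {p p' s q} → step p τ p' → WT p' s q → WT p s q
    wt-act  : ∀ {p p' μ s q} → step p (vis μ) p' → WT p' s q → WT p (μ ∷ s) q

  Stable : State → Set
  Stable q = ¬ (∃ λ q' → step q τ q')

  _∈ws[_,_] : State → State → List Act → Set
  q ∈ws[ p , s ] = WT p s q × Stable q

  _∈R_ : Act → State → Set
  μ ∈R t = ∃ λ t' → step t (vis μ) t'

  _∈coR_ : BAct → State → Set
  β ∈coR p = ∃ λ p' → step p (vis (dual (proj₁ β))) p'

record TestLTS (S : Setting) : Set₁ where
  open Setting S
  field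
    lts   : LTS S
  open LTS lts public
  field
    good      : State → Set
    good?     : ∀ t → Dec (good t)
    good-fwd  : ∀ {η t t'} → N η → step t (vis η) t' → good t → good t'
    good-bwd  : ∀ {η t t'} → N η → step t (vis η) t' → good t' → good t

module _ {S : Setting} (L : LTS S) (T : TestLTS S) where
  open Setting S
  private
    module L = LTS L
    module T = TestLTS T

  Conf : Set
  Conf = L.State × T.State

  data CStep : Conf → Conf → Set where
    c-tauL : ∀ {p p' t} → L.step p τ p' → CStep (p , t) (p' , t)
    c-tauT : ∀ {p t t'} → T.step t τ t' → CStep (p , t) (p , t')
    c-com  : ∀ {p p' t t' μ} → L.step p (vis (dual μ)) p' → T.step t (vis μ) t' →
             CStep (p , t) (p' , t')

  Stuck : Conf → Set
  Stuck c = ∀ c' → ¬ CStep c c'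

  -- finite maximal computation f 0, …, f n (values beyond n are irrelevant)
  FinMaxComp : Conf → ℕ → (ℕ → Conf) → Set
  FinMaxComp c n f = f 0 ≡ c × (∀ i → i < n → CStep (f i) (f (ℕ.suc i))) × Stuck (f n)
    where import Data.Nat as ℕ

  InfComp : Conf → (ℕ → Conf) → Set
  InfComp c f = f 0 ≡ c × (∀ i → CStep (f i) (f (ℕ.suc i)))
    where import Data.Nat as ℕ

  Must : L.State → T.State → Set
  Must p t = (∀ n f → FinMaxComp (p , t) n f → ∃ λ i → i ≤ n × T.good (proj₂ (f i)))
           × (∀ f → InfComp (p , t) f → ∃ λ i → T.good (proj₂ (f i)))

module _ {S : Setting} (L : LTS S) (T : TestLTS S) {Y X : Set}
         (φ : Setting.BAct S → Y) (δ : Y → X) where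
  open Setting S
  private
    module L = LTS L
    module T = TestLTS T

  _∈φcoR_ : Y → L.State → Set
  y ∈φcoR p = ∃ λ β → _∈coR_ L β p × φ β ≡ y

  _∈coRA_ : X → L.State → Set
  x ∈coRA p = ∃ λ β → _∈coR_ L β p × δ (φ β) ≡ x

  record Abstracts : Set where
    field
      abs-i  : ∀ (β β' : BAct) (t : T.State) → φ β ≡ φ β' →
               _∈R_ T.lts (proj₁ β) t → _∈R_ T.lts (proj₁ β') t
      abs-ii : ∀ (β β' : BAct) (p : L.State) → δ (φ β) ≡ δ (φ β') →
               φ β ∈φcoR p → φ β' ∈φcoR p

  record CmplFun (f : List Act → T.State) : Set where
    field
      c-1 : ∀ s → ¬ T.good (f s)
      c-2 : ∀ μ s → T.step (f (μ ∷ s)) (vis μ) (f s)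
      c-3 : ∀ μ s → B μ → ∃ λ t → T.step (f (μ ∷ s)) τ t
      c-4 : ∀ μ s t → B μ → T.step (f (μ ∷ s)) τ t → T.good t
      c-5 : ∀ μ s t → B μ → T.step (f (μ ∷ s)) (vis μ) t → t ≡ f s
      c-6 : ∀ μ μ' s t → B μ → T.step (f (μ ∷ s)) (vis μ') t → μ' ≢ μ → T.good t

  -- (𝓣, 𝔸) ⊨ AxCmpl with witnesses t_cnv, t_acc (finite subsets of X as lists)
  record AxCmpl (tcnv : List Act → T.State) (tacc : List Act → List X → T.State) : Set where
    field
      cnv-fun : CmplFun tcnv
      acc-fun : ∀ E → CmplFun (λ s → tacc s E)
      a1 : ∀ E → ¬ (∃ λ t → T.step (tacc [] E) τ t)
      a2 : ∀ E η → N η → ¬ (∃ λ t → T.step (tacc [] E) (vis η) t)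
      a3 : ∀ E (β : BAct) t → T.step (tacc [] E) (vis (proj₁ β)) t → δ (φ β) ∈ E
      a4 : ∀ E e → e ∈ E → ∃ λ (β : BAct) → (∃ λ t → T.step (tacc [] E) (vis (proj₁ β)) t)
                                              × δ (φ β) ≡ e
      a5 : ∀ E (β : BAct) t → T.step (tacc [] E) (vis (proj₁ β)) t → T.good t
      c1 : ∀ μ → ¬ (∃ λ t → T.step (tcnv []) (vis μ) t)
      c2 : ∃ λ t → T.step (tcnv []) τ t
      c3 : ∀ t → T.step (tcnv []) τ t → T.good t

-- A weak trace q =s=> q' is mirrored step by step by t_acc(s̄, E'), each
-- visible step μ of q synchronising with the μ̄-step that (2) guarantees.
-- By (1) no test on the way is good, and the computation ends in
-- (q', t_acc(ε, E')), which is stuck: q' is stable, t_acc(ε, E') has no τ-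
-- or N-moves (a1, a2), and its B-moves carry labels in E' (a3), which avoids
-- coR_𝔸(q'). This finite maximal computation refutes Must.
module Submission where

open import Defs
open import Data.Nat using (ℕ; zero; suc; _<_; s≤s)
open import Data.List using (List; map; []; _∷_)
open import Data.List.Membership.Propositional using (_∈_)
open import Data.Product using (_×_; _,_; proj₁; proj₂)
open import Relation.Nullary using (¬_)
open import Level using (0ℓ)
open import Relation.Binary.Core using (Rel)
open import Relation.Binary.Construct.Closure.ReflexiveTransitive using (Star; ε; _◅_)
open import Relation.Binary.PropositionalEquality using (_≡_; refl; sym; subst)
open import Function.Bundles using (_⇔_; Equivalence)

module _ {I : Set} {R : Rel I 0ℓ} where

  length : ∀ {i j} → Star R i j → ℕ
  length ε        = 0
  length (_ ◅ xs) = suc (length xs)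

  -- Past the end of the path, lookup stays at its last point.
  lookup : ∀ {i j} → Star R i j → ℕ → I
  lookup {i} ε        _       = i
  lookup {i} (_ ◅ _)  zero    = i
  lookup     (_ ◅ xs) (suc k) = lookup xs k

  lookup-zero : ∀ {i j} (r : Star R i j) → lookup r 0 ≡ i
  lookup-zero ε       = refl
  lookup-zero (_ ◅ _) = refl

  lookup-length : ∀ {i j} (r : Star R i j) → lookup r (length r) ≡ j
  lookup-length ε        = refl
  lookup-length (_ ◅ xs) = lookup-length xs

  lookup-step : ∀ {i j} (r : Star R i j) k → k < length r →
                R (lookup r k) (lookup r (suc k))
  lookup-step (x ◅ xs) zero    _         = subst (R _) (sym (lookup-zero xs)) x
  lookup-step (_ ◅ xs) (suc k) (s≤s k<n) = lookup-step xs k k<n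

  lookup-all : ∀ {P : I → Set} → (∀ {a b} → R a b → P a) →
               ∀ {i j} (r : Star R i j) → P j → ∀ k → P (lookup r k)
  lookup-all src ε        Pj _       = Pj
  lookup-all src (x ◅ _)  _  zero    = src x
  lookup-all src (_ ◅ xs) Pj (suc k) = lookup-all src xs Pj k

module _ {S : Setting} (L : LTS S) (T : TestLTS S) where
  open Setting S
  open TestLTS T using (good)

  GoodFreeStep : Rel (Conf L T) 0ℓ
  GoodFreeStep c c' = ¬ good (proj₂ c) × CStep L T c c'

  stuck-good-free-run⇒¬Must : ∀ {p t c} → Star GoodFreeStep (p , t) c →
                              ¬ good (proj₂ c) → Stuck L T c → ¬ Must L T p t
  stuck-good-free-run⇒¬Must r ¬good-c stuck (must-fin , _)
    with must-fin (length r) (lookup r) (lookup-zero r , steps , last-stuck)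
    where
      steps : ∀ k → k < length r → CStep L T (lookup r k) (lookup r (suc k))
      steps k k<n = proj₂ (lookup-step r k k<n)
      last-stuck : Stuck L T (lookup r (length r))
      last-stuck = subst (Stuck L T) (sym (lookup-length r)) stuck
  ... | k , _ , good-k = lookup-all proj₁ r ¬good-c k good-k

  weak-trace⇒good-free-run :
    (f : List Act → TestLTS.State T) →
    (∀ s → ¬ good (f s)) →
    (∀ μ s → TestLTS.step T (f (μ ∷ s)) (vis μ) (f s)) →
    ∀ {p s q} → WT L p s q → Star GoodFreeStep (p , f (map dual s)) (q , f [])
  weak-trace⇒good-free-run f ¬good f-step = go
    where
      go : ∀ {p s q} → WT L p s q → Star GoodFreeStep (p , f (map dual s)) (q , f [])
      go wt-refl = ε
      go (wt-tau p⟶p' w) = (¬good _ , c-tauL p⟶p') ◅ go w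
      go {s = μ ∷ s} (wt-act p⟶p' w) =
        (¬good _ , c-com p⟶p'-dual² (f-step (dual μ) (map dual s))) ◅ go w
        where
          p⟶p'-dual² : LTS.step L _ (vis (dual (dual μ))) _
          p⟶p'-dual² = subst (λ a → LTS.step L _ (vis a) _) (sym (dual-invol μ)) p⟶p'

module _ {S : Setting} {L : LTS S} {T : TestLTS S} {Y X : Set}
         {φ : Setting.BAct S → Y} {δ : Y → X}
         {tcnv : List (Setting.Act S) → TestLTS.State T}
         {tacc : List (Setting.Act S) → List X → TestLTS.State T}
         (ax : AxCmpl L T φ δ tcnv tacc) where
  open AxCmpl ax

  stable-tacc-ε-stuck : ∀ {q E} → Stable L q → (∀ x → x ∈ E → ¬ _∈coRA_ L T φ δ x q) →
                        Stuck L T (q , tacc [] E)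
  stable-tacc-ε-stuck q-stable _ _ (c-tauL q⟶) = q-stable (_ , q⟶)
  stable-tacc-ε-stuck _ _ _ (c-tauT t⟶) = a1 _ (_ , t⟶)
  stable-tacc-ε-stuck {E = E} _ E∩coR=∅ _ (c-com {μ = μ} q⟶ t⟶) =
    E∩coR=∅ _ (a3 E β _ t⟶) (β , (_ , q⟶) , refl)
    where
      β : Setting.BAct S
      β = μ , λ N-μ → a2 E μ N-μ (_ , t⟶)

lemma24 : (S : Setting) (L : LTS S) (T : TestLTS S) {Y X : Set}
    (φ : Setting.BAct S → Y) (δ : Y → X) →
    InM L → InA (TestLTS.lts T) → Abstracts L T φ δ →
    (tcnv : List (Setting.Act S) → TestLTS.State T)
    (tacc : List (Setting.Act S) → List X → TestLTS.State T) →
    AxCmpl L T φ δ tcnv tacc →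
    ∀ (q q' : LTS.State L) (s : List (Setting.Act S)) (E E' : List X) →
    (∀ x → (x ∈ E') ⇔ (x ∈ E × ¬ (_∈coRA_ L T φ δ x q'))) →
    _∈ws[_,_] L q' q s →
    ¬ Must L T q (tacc (map (Setting.dual S) s) E')
lemma24 S L T φ δ _ _ _ _ tacc ax q q' s _ E' E'-spec (q⇒q' , q'-stable) =
  stuck-good-free-run⇒¬Must L T run (c-1 []) (stable-tacc-ε-stuck ax q'-stable E'∩coR=∅)
  where
    open CmplFun (AxCmpl.acc-fun ax E')
    run : Star (GoodFreeStep L T) (q , tacc (map (Setting.dual S) s) E') (q' , tacc [] E')
    run = weak-trace⇒good-free-run L T (λ s → tacc s E') c-1 c-2 q⇒q'
    E'∩coR=∅ : ∀ x → x ∈ E' → ¬ _∈coRA_ L T φ δ x q'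
    E'∩coR=∅ x x∈E' = proj₂ (Equivalence.to (E'-spec x) x∈E')
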